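{- For any complete graph $K_n$ of order $n\ge 4$, $\gamma_{tc}(M(K_n))=\lceil 2n/3\rceil$.
   Context: All graphs are finite, simple and undirected. For a graph $H$, a set $D\subseteq V(H)$ is a total dominating set if every vertex of $H$ has a neighbor in $D$. A set $D\subseteq V(H)$ is a total outer-connected dominating set of $H$ if $D$ is a total dominating set and the induced subgraph $H[V(H)\setminus D]$ is connected; $\gamma_{tc}(H)$ denotes the minimum cardinality of a total outer-connected dominating set of $H$. The middle graph $M(G)$ of a graph $G$ has vertex set $V(G)\cup E(G)$, where two elements $x,y$ are adjacent iff either $x,y\in E(G)$ are edges of $G$ sharing an endpoint, or one of them is a vertex of $G$ and the other is an edge of $G$ incident to it. -}

module Defs where

open import Level using (0ℓ)
open import Data.Nat using (ℕ; _≤_; _<_; _*_; _+_)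
open import Data.Nat.DivMod using (_/_)
open import Data.Fin using (Fin)
import Data.Fin as F
open import Data.Product using (Σ; ∃; _×_; _,_)
open import Data.Sum using (_⊎_; inj₁; inj₂)
open import Data.Empty using (⊥)
open import Data.List using (List; length)
open import Data.List.Membership.Propositional using (_∈_; _∉_)
open import Data.List.Relation.Unary.Unique.Propositional using (Unique)
open import Relation.Nullary using (¬_)
open import Relation.Binary.PropositionalEquality using (_≡_; _≢_)

record Graph : Set₁ where
  field
    V   : Set
    Adj : V → V → Set
open Graph public

K : ℕ → Graph
K n = record { V = Fin n ; Adj = λ i j → i ≢ j }

-- Edges of a graph on Fin n, each unordered edge {i,j} represented once as i < j.
Edge : (n : ℕ) → (Fin n → Fin n → Set) → Set
Edge n A = Σ (Fin n) λ i → Σ (Fin n) λ j → (i F.< j) × A i j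

endpt₁ : ∀ {n A} → Edge n A → Fin n
endpt₁ (i , _ , _) = i

endpt₂ : ∀ {n A} → Edge n A → Fin n
endpt₂ (_ , j , _) = j

Inc : ∀ {n A} → Fin n → Edge n A → Set
Inc v e = (v ≡ endpt₁ e) ⊎ (v ≡ endpt₂ e)

ShareEnd : ∀ {n A} → Edge n A → Edge n A → Set
ShareEnd e f =
  ¬ (endpt₁ e ≡ endpt₁ f × endpt₂ e ≡ endpt₂ f) ×
  ((endpt₁ e ≡ endpt₁ f) ⊎ (endpt₁ e ≡ endpt₂ f) ⊎ (endpt₂ e ≡ endpt₁ f) ⊎ (endpt₂ e ≡ endpt₂ f))

MAdj : ∀ {n A} → (Fin n ⊎ Edge n A) → (Fin n ⊎ Edge n A) → Set
MAdj (inj₁ _) (inj₁ _) = ⊥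
MAdj (inj₁ v) (inj₂ e) = Inc v e
MAdj (inj₂ e) (inj₁ v) = Inc v e
MAdj (inj₂ e) (inj₂ f) = ShareEnd e f

Middle : (n : ℕ) → (Fin n → Fin n → Set) → Graph
Middle n A = record { V = Fin n ⊎ Edge n A ; Adj = MAdj }

-- Walks in G all of whose vertices satisfy P (i.e. walks in the induced subgraph on P).
data WalkIn (G : Graph) (P : V G → Set) : V G → V G → Set where
  here : ∀ {u} → P u → WalkIn G P u u
  step : ∀ {u w x} → P u → Adj G u w → WalkIn G P w x → WalkIn G P u x

TotalDominating : (G : Graph) → List (V G) → Set
TotalDominating G D = ∀ v → ∃ λ u → u ∈ D × Adj G v u

OuterConnected : (G : Graph) → List (V G) → Set
OuterConnected G D = ∀ u w → u ∉ D → w ∉ D → WalkIn G (λ x → x ∉ D) u w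

-- D (a duplicate-free list, i.e. a finite set) is a total outer-connected dominating set.
IsTOCDS : (G : Graph) → List (V G) → Set
IsTOCDS G D = Unique D × TotalDominating G D × OuterConnected G D

γtc≡ : Graph → ℕ → Set
γtc≡ G k = (∃ λ D → IsTOCDS G D × length D ≡ k) × (∀ D → IsTOCDS G D → k ≤ length D)

⌈_/3⌉ : ℕ → ℕ
⌈ m /3⌉ = (m + 2) / 3

module Submission where

-- Let D be a total dominating set of M(G) for a graph G on n vertices.  Each
-- vertex x of G is dominated by an element `dominator x` of D having x as an endpoint, and
-- each element k of D has a neighbour `partner k` in D sharing an endpoint with it.  Give
-- every vertex two tokens and send them injectively into |D| × 3 slots: the first token of
-- x goes to slot (dominator x , 1 + p), where p is the position of x in its dominator; the
-- second goes to the spare slot (dominator x , 0), except when the dominator is "full"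
-- (dominates both of its endpoints) and x is its second endpoint, in which case it goes to
-- (partner k , 1 + p′) with p′ the position of the endpoint shared by k and partner k.
-- That slot is free, because the shared endpoint is dominated by k and not by partner k.
-- Hence 2n ≤ 3|D|.
--
-- Write n = 3(q + 1) + r with r < 3 and split the vertices of K_n into
-- triples (j,0), (j,1), (j,2) and r extra vertices.  The path edges (j,0)(j,1), (j,1)(j,2)
-- and the spokes joining each extra vertex to (0,0) form a total dominating set of size
-- 2(q + 1) + r = ⌈2n/3⌉.  Its complement is connected: every vertex reaches the hub (0,2)
-- through an edge outside the set, since the only chosen edge at the hub is (0,1)(0,2),
-- and (0,1) detours through a vertex outside the first triple, which exists as n ≥ 4.

open import Defs
open import Data.Nat using (ℕ; suc; _≤_; _*_; _+_; _<_; s≤s; z<s)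
open import Data.Nat.Properties
  using (n≮n; <-asym; +-identityʳ; +-monoˡ-≤; +-monoʳ-<; ≤-pred; n<1+n; *-comm; +-comm; module ≤-Reasoning)
open import Data.Nat.DivMod using (_/_; m<n*o⇒m/o<n; /-congˡ; +-distrib-/-∣ˡ; m*n/n≡m; _divMod_; result)
open import Data.Nat.Divisibility using (divides-refl)
open import Data.Nat.Tactic.RingSolver using (solve-∀)
open import Data.Fin using (Fin; zero; suc; toℕ; inject₁; combine)
import Data.Fin as F
import Data.Fin.Properties as F
open import Data.Fin.Properties
  using (_≟_; suc-injective; <-cmp; toℕ-↑ˡ; toℕ-combine; ≤̄⇒inject₁<; +↔⊎; *↔×; all?; injective⇒≤)
open import Data.Product using (∃; ∃₂; _×_; _,_; proj₁; proj₂; uncurry)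
open import Data.Product.Properties using (,-injectiveˡ; ,-injectiveʳ)
open import Data.Sum using (_⊎_; inj₁; inj₂; [_,_]′)
open import Data.Sum.Properties using (inj₂-injective)
open import Data.Sum.Function.Propositional using (_⊎-↔_)
open import Data.Empty using (⊥; ⊥-elim)
open import Data.List using (List; length; lookup; map; allFin)
open import Data.List.Properties using (length-map; length-tabulate)
open import Data.List.Membership.Propositional using (_∈_; _∉_)
open import Data.List.Membership.Propositional.Properties using (∈-map⁺; ∈-map⁻; ∈-allFin)
open import Data.List.Relation.Unary.Any using (index)
open import Data.List.Relation.Unary.Any.Properties using (lookup-index)
open import Data.List.Relation.Unary.Unique.Propositional using (Unique)
open import Data.List.Relation.Unary.Unique.Propositional.Properties using (map⁺; allFin⁺)
open import Function using (_∘_; id)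
open import Function.Bundles using (_↔_; Inverse; Injection)
open import Function.Properties.Inverse using (Inverse⇒Injection; ↔-sym; ↔-trans; ↔-refl)
open import Relation.Binary.Definitions using (tri<; tri≈; tri>)
open import Relation.Nullary using (¬_; Dec; yes; no)
open import Relation.Nullary.Decidable using (_×-dec_)
open import Relation.Binary.PropositionalEquality

module _ {G : Graph} {P : V G → Set} where

  walk-++ : ∀ {u w x} → WalkIn G P u w → WalkIn G P w x → WalkIn G P u x
  walk-++ (here _)        walk′ = walk′
  walk-++ (step pu a walk) walk′ = step pu a (walk-++ walk walk′)

  walk-reverse : (∀ {u w} → Adj G u w → Adj G w u) → ∀ {u w} → WalkIn G P u w → WalkIn G P w u
  walk-reverse sym-adj (here pu)        = here pu
  walk-reverse sym-adj (step pu a walk) =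
    walk-++ (walk-reverse sym-adj walk) (step (walk-start walk) (sym-adj a) (here pu))
    where
    walk-start : ∀ {u w} → WalkIn G P u w → P u
    walk-start (here pu)     = pu
    walk-start (step pu _ _) = pu

pairs-injective⇒≤ : ∀ {a b c d} (f : Fin a × Fin b → Fin c × Fin d) →
                    (∀ {u v} → f u ≡ f v → u ≡ v) → a * b ≤ c * d
pairs-injective⇒≤ f f-injective = injective⇒≤ {f = Inverse.from *↔× ∘ f ∘ Inverse.to *↔×}
  (Injection.injective (Inverse⇒Injection *↔×) ∘ f-injective ∘ Injection.injective (Inverse⇒Injection (↔-sym *↔×)))

2n≤3m⇒⌈2n/3⌉≤m : ∀ {n m} → n * 2 ≤ m * 3 → ⌈ 2 * n /3⌉ ≤ m
2n≤3m⇒⌈2n/3⌉≤m {n} {m} 2n≤3m = ≤-pred (m<n*o⇒m/o<n (begin-strict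
  2 * n + 2  <⟨ +-monoʳ-< (2 * n) (n<1+n 2) ⟩
  2 * n + 3  ≤⟨ +-monoˡ-≤ 3 (subst (_≤ m * 3) (*-comm n 2) 2n≤3m) ⟩
  m * 3 + 3  ≡⟨ +-comm (m * 3) 3 ⟩
  suc m * 3  ∎))
  where open ≤-Reasoning

module _ {n : ℕ} {A : Fin n → Fin n → Set} where

  private
    M : Graph
    M = Middle n A

  SameEnds : Edge n A → Edge n A → Set
  SameEnds e f = endpt₁ e ≡ endpt₁ f × endpt₂ e ≡ endpt₂ f

  shareEnd : ∀ {x} {e f : Edge n A} → Inc x e → Inc x f → ¬ SameEnds e f → ShareEnd e f
  shareEnd (inj₁ refl) (inj₁ x≡) different = different , inj₁ x≡
  shareEnd (inj₁ refl) (inj₂ x≡) different = different , inj₂ (inj₁ x≡)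
  shareEnd (inj₂ refl) (inj₁ x≡) different = different , inj₂ (inj₂ (inj₁ x≡))
  shareEnd (inj₂ refl) (inj₂ x≡) different = different , inj₂ (inj₂ (inj₂ x≡))

  shareEnd-sameEnds : ∀ {e f g : Edge n A} → SameEnds e f → ShareEnd f g → ShareEnd e g
  shareEnd-sameEnds (refl , refl) f~g = f~g

  shared-vertex : ∀ {e f : Edge n A} → ShareEnd e f → ∃ λ x → Inc x e × Inc x f
  shared-vertex (_ , inj₁ p)               = _ , inj₁ refl , inj₁ p
  shared-vertex (_ , inj₂ (inj₁ p))        = _ , inj₁ refl , inj₂ p
  shared-vertex (_ , inj₂ (inj₂ (inj₁ p))) = _ , inj₂ refl , inj₁ p
  shared-vertex (_ , inj₂ (inj₂ (inj₂ p))) = _ , inj₂ refl , inj₂ p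

  MAdj-sym : ∀ {u w} → Adj M u w → Adj M w u
  MAdj-sym {inj₁ _} {inj₂ _} x∈e = x∈e
  MAdj-sym {inj₂ _} {inj₁ _} x∈e = x∈e
  MAdj-sym {inj₂ e} {inj₂ f} e~f@(different , _) with shared-vertex {e} {f} e~f
  ... | x , x∈e , x∈f = shareEnd {e = f} {e} x∈f x∈e λ (p , q) → different (sym p , sym q)

  MAdj-irrefl : ∀ u → ¬ Adj M u u
  MAdj-irrefl (inj₂ e) (distinct , _) = distinct (refl , refl)

  endpoint : V M → Fin 2 → Fin n
  endpoint (inj₁ v) _       = v
  endpoint (inj₂ e) zero    = endpt₁ e
  endpoint (inj₂ e) (suc _) = endpt₂ e

  Incident : Fin n → V M → Set
  Incident x u = ∃ λ p → x ≡ endpoint u p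

  inc⇒incident : ∀ {x} {e : Edge n A} → Inc x e → Incident x (inj₂ e)
  inc⇒incident (inj₁ x≡) = zero , x≡
  inc⇒incident (inj₂ x≡) = suc zero , x≡

  adj-vertex⇒incident : ∀ {x u} → Adj M (inj₁ x) u → Incident x u
  adj-vertex⇒incident {u = inj₂ e} = inc⇒incident

  adj⇒shared-endpoint : ∀ {u w} → Adj M u w → ∃ λ p → Incident (endpoint w p) u
  adj⇒shared-endpoint {inj₁ x} {inj₂ e} x∈e with inc⇒incident x∈e
  ... | p , x≡ = p , zero , sym x≡
  adj⇒shared-endpoint {inj₂ e} {inj₁ x} x∈e = zero , inc⇒incident x∈e
  adj⇒shared-endpoint {inj₂ e} {inj₂ f} e~f with shared-vertex {e} {f} e~f
  ... | x , x∈e , x∈f with inc⇒incident {e = f} x∈f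
  ...   | p , refl = p , inc⇒incident x∈e

  module Charging (D : List (V M)) (td : TotalDominating M D) where

    element : Fin (length D) → V M
    element = lookup D

    private
      pick : ∀ {R : V M → Set} → (∃ λ u → u ∈ D × R u) → ∃ λ k → R (element k)
      pick {R} (u , u∈D , Ru) = index u∈D , subst R (lookup-index u∈D) Ru

      dominating : ∀ x → ∃ λ k → Incident x (element k)
      dominating x with pick (td (inj₁ x))
      ... | k , adj = k , adj-vertex⇒incident adj

      neighbouring : ∀ k → ∃ λ k′ → Adj M (element k) (element k′)
      neighbouring k = pick (td (element k))

    dominator : Fin n → Fin (length D)
    dominator x = proj₁ (dominating x)

    position : Fin n → Fin 2
    position x = proj₁ (proj₂ (dominating x))

    x≡endpoint : ∀ x → x ≡ endpoint (element (dominator x)) (position x)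
    x≡endpoint x = proj₂ (proj₂ (dominating x))

    partner : Fin (length D) → Fin (length D)
    partner k = proj₁ (neighbouring k)

    partner≢ : ∀ k → partner k ≢ k
    partner≢ k eq = MAdj-irrefl (element k) (subst (Adj M (element k) ∘ element) eq (proj₂ (neighbouring k)))

    sharedPosition : Fin (length D) → Fin 2
    sharedPosition k = proj₁ (adj⇒shared-endpoint (proj₂ (neighbouring k)))

    shared-incident : ∀ k → Incident (endpoint (element (partner k)) (sharedPosition k)) (element k)
    shared-incident k = proj₂ (adj⇒shared-endpoint (proj₂ (neighbouring k)))

    Full : Fin (length D) → Set
    Full k = ∀ p → dominator (endpoint (element k) p) ≡ k

    full? : ∀ k → Dec (Full k)
    full? k = all? λ p → dominator (endpoint (element k) p) ≟ k

    full-dominates : ∀ {k x} → Full k → Incident x (element k) → dominator x ≡ k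
    full-dominates full (p , refl) = full p

    dominator-endpoint : ∀ {x k p} → dominator x ≡ k → position x ≡ p →
                         dominator (endpoint (element k) p) ≡ k
    dominator-endpoint {x} refl refl = cong dominator (sym (x≡endpoint x))

    dominator-position-injective : ∀ {x y} → dominator x ≡ dominator y → position x ≡ position y → x ≡ y
    dominator-position-injective {x} {y} d≡ p≡ =
      trans (x≡endpoint x) (trans (cong₂ (endpoint ∘ element) d≡ p≡) (sym (x≡endpoint y)))

    Overflow : Fin n → Set
    Overflow x = position x ≡ suc zero × Full (dominator x)

    overflow? : ∀ x → Dec (Overflow x)
    overflow? x = position x ≟ suc zero ×-dec full? (dominator x)

    token : Fin n → Fin 2 → Fin (length D) × Fin 3
    token x zero          = dominator x , suc (position x)
    token x (suc zero) with overflow? x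
    ... | yes _ = partner (dominator x) , suc (sharedPosition (dominator x))
    ... | no _  = dominator x , zero

    overflow-target-unused : ∀ {x k} → Full k → dominator x ≡ partner k →
                             position x ≡ sharedPosition k → ⊥
    overflow-target-unused {x} {k} full d≡ p≡ = partner≢ k (trans (sym d≡) dx≡k)
      where
      dx≡k : dominator x ≡ k
      dx≡k = full-dominates full
        (subst (λ z → Incident z (element k))
               (sym (trans (x≡endpoint x) (cong₂ (endpoint ∘ element) d≡ p≡)))
               (shared-incident k))

    overflow-injective : ∀ {k k′} → Full k → Full k′ → partner k ≡ partner k′ →
                         sharedPosition k ≡ sharedPosition k′ → k ≡ k′
    overflow-injective {k} {k′} full full′ q≡ p≡ =
      trans (sym (full-dominates full (shared-incident k)))
            (trans (cong dominator (cong₂ (endpoint ∘ element) q≡ p≡))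
                   (full-dominates full′ (shared-incident k′)))

    spare-injective : ∀ {x y} → ¬ Overflow x → ¬ Overflow y → dominator x ≡ dominator y → x ≡ y
    spare-injective {x} {y} ¬ox ¬oy d≡ with position x in px | position y in py
    ... | zero     | zero     = dominator-position-injective d≡ (trans px (sym py))
    ... | suc zero | suc zero = dominator-position-injective d≡ (trans px (sym py))
    ... | zero     | suc zero = ⊥-elim (¬oy (refl , λ where
            zero       → dominator-endpoint d≡ px
            (suc zero) → dominator-endpoint refl py))
    ... | suc zero | zero     = ⊥-elim (¬ox (refl , λ where
            zero       → dominator-endpoint (sym d≡) py
            (suc zero) → dominator-endpoint refl px))

    first-token≢second-token : ∀ x y → token x zero ≢ token y (suc zero)
    first-token≢second-token x y eq with overflow? y
    ... | yes (_ , full) = overflow-target-unused full (,-injectiveˡ eq) (suc-injective (,-injectiveʳ eq))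
    ... | no _ with () ← ,-injectiveʳ eq

    second-token-injective : ∀ x y → token x (suc zero) ≡ token y (suc zero) → x ≡ y
    second-token-injective x y eq with overflow? x | overflow? y
    ... | yes (px , fx) | yes (py , fy) = dominator-position-injective
            (overflow-injective fx fy (,-injectiveˡ eq) (suc-injective (,-injectiveʳ eq))) (trans px (sym py))
    ... | no ¬ox | no ¬oy = spare-injective ¬ox ¬oy (,-injectiveˡ eq)
    ... | yes _ | no _ with () ← ,-injectiveʳ eq
    ... | no _ | yes _ with () ← ,-injectiveʳ eq

    token-injective : ∀ {x y b c} → token x b ≡ token y c → x ≡ y × b ≡ c
    token-injective {x} {y} {zero} {zero} eq =
      dominator-position-injective (,-injectiveˡ eq) (suc-injective (,-injectiveʳ eq)) , refl
    token-injective {x} {y} {zero} {suc zero} eq = ⊥-elim (first-token≢second-token x y eq)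
    token-injective {x} {y} {suc zero} {zero} eq = ⊥-elim (first-token≢second-token y x (sym eq))
    token-injective {x} {y} {suc zero} {suc zero} eq = second-token-injective x y eq , refl

  totalDominating-size : ∀ {D} → TotalDominating M D → n * 2 ≤ length D * 3
  totalDominating-size {D} td = pairs-injective⇒≤ (uncurry token) λ eq →
    let x≡y , b≡c = token-injective eq in cong₂ _,_ x≡y b≡c
    where open Charging D td

module _ {n : ℕ} {A : Fin n → Fin n → Set} where

  private
    M : Graph
    M = Middle n A

  totalDominating-middle : ∀ D → (∀ x → ∃ λ e → inj₂ e ∈ D × Inc x e) →
                           (∀ e → inj₂ e ∈ D → ∃ λ f → inj₂ f ∈ D × ShareEnd e f) →
                           TotalDominating M D
  totalDominating-middle D cover _ (inj₁ x) with cover x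
  ... | e , e∈D , x∈e = inj₂ e , e∈D , x∈e
  totalDominating-middle D cover neighbour (inj₂ e) with cover (endpt₁ e)
  ... | f , f∈D , x∈f with (endpt₁ e ≟ endpt₁ f) ×-dec (endpt₂ e ≟ endpt₂ f)
  ...   | no different = inj₂ f , f∈D , shareEnd {e = e} {f} (inj₁ refl) x∈f different
  ...   | yes same with neighbour f f∈D
  ...     | g , g∈D , f~g = inj₂ g , g∈D , shareEnd-sameEnds {e = e} {f} {g} same f~g

  walk-via-edge : ∀ {D x y} {e : Edge n A} → inj₁ x ∉ D → inj₁ y ∉ D → inj₂ e ∉ D → Inc x e → Inc y e →
        WalkIn M (_∉ D) (inj₁ x) (inj₁ y)
  walk-via-edge x∉D y∉D e∉D x∈e y∈e = step x∉D x∈e (step e∉D y∈e (here y∉D))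

  outerConnected-viaHub : ∀ D (hub : Fin n) → (∀ x → inj₁ x ∉ D) →
                          (∀ x → WalkIn M (_∉ D) (inj₁ x) (inj₁ hub)) → OuterConnected M D
  outerConnected-viaHub D hub vertex∉D to-hub u w u∉D w∉D =
    walk-++ (from u u∉D) (walk-reverse MAdj-sym (from w w∉D))
    where
    from : ∀ u → u ∉ D → WalkIn M (_∉ D) u (inj₁ hub)
    from (inj₁ x) _   = to-hub x
    from (inj₂ e) e∉D = step e∉D (inj₁ refl) (to-hub (endpt₁ e))

joining-edge : ∀ {n} {x y : Fin n} → x ≢ y → ∃ λ (e : Edge n (Adj (K n))) → Inc x e × Inc y e
joining-edge {x = x} {y} x≢y with <-cmp x y
... | tri< x<y _ _ = (x , y , x<y , x≢y) , inj₁ refl , inj₂ refl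
... | tri≈ _ x≡y _ = ⊥-elim (x≢y x≡y)
... | tri> _ _ y<x = (y , x , y<x , x≢y ∘ sym) , inj₂ refl , inj₁ refl

module Construction (q r : ℕ) (3<n : 3 < suc q * 3 + r) where

  pattern path j s = inj₁ (j , s)
  pattern spoke t  = inj₂ t

  private
    n : ℕ
    n = suc q * 3 + r
    M : Graph
    M = Middle n (Adj (K n))

  vertexLabel : Fin n ↔ (Fin (suc q) × Fin 3 ⊎ Fin r)
  vertexLabel = ↔-trans +↔⊎ (*↔× ⊎-↔ ↔-refl)

  vertex : Fin (suc q) × Fin 3 ⊎ Fin r → Fin n
  vertex = Inverse.from vertexLabel

  vertex-injective : ∀ a b → vertex a ≡ vertex b → a ≡ b
  vertex-injective a b = Injection.injective (Inverse⇒Injection (↔-sym vertexLabel))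

  triple : Fin (suc q) → Fin 3 → Fin n
  triple j c = vertex (inj₁ (j , c))

  extra : Fin r → Fin n
  extra t = vertex (inj₂ t)

  toℕ-triple : ∀ j c → toℕ (triple j c) ≡ 3 * toℕ j + toℕ c
  toℕ-triple j c = trans (toℕ-↑ˡ (combine j c) r) (toℕ-combine j c)

  Slot : Set
  Slot = Fin (suc q) × Fin 2 ⊎ Fin r

  chosen : Slot → Edge n (Adj (K n))
  chosen (path j s) = triple j (inject₁ s) , triple j (suc s) , ordered , F.<⇒≢ ordered
    where
    ordered : triple j (inject₁ s) F.< triple j (suc s)
    ordered = subst₂ _<_ (sym (toℕ-triple j (inject₁ s))) (sym (toℕ-triple j (suc s)))
                (+-monoʳ-< (3 * toℕ j) (≤̄⇒inject₁< F.≤-refl))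
  chosen (spoke t)  = triple zero zero , extra t , z<s , F.<⇒≢ z<s

  slotIndex : Fin (suc q * 2 + r) ↔ Slot
  slotIndex = ↔-trans +↔⊎ (*↔× ⊎-↔ ↔-refl)

  chosenAt : Fin (suc q * 2 + r) → V M
  chosenAt = inj₂ ∘ chosen ∘ Inverse.to slotIndex

  chosenSet : List (V M)
  chosenSet = map chosenAt (allFin (suc q * 2 + r))

  chosen-key-injective : ∀ {s s′} → endpt₂ (chosen s) ≡ endpt₂ (chosen s′) → s ≡ s′
  chosen-key-injective {path j a} {path k b} eq with vertex-injective (inj₁ (j , suc a)) (inj₁ (k , suc b)) eq
  ... | refl = refl
  chosen-key-injective {path j a} {spoke t}  eq with vertex-injective (inj₁ (j , suc a)) (inj₂ t) eq
  ... | ()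
  chosen-key-injective {spoke t}  {path j a} eq with vertex-injective (inj₂ t) (inj₁ (j , suc a)) eq
  ... | ()
  chosen-key-injective {spoke t}  {spoke u}  eq with vertex-injective (inj₂ t) (inj₂ u) eq
  ... | refl = refl

  chosenSet-unique : Unique chosenSet
  chosenSet-unique = map⁺ chosenAt-injective (allFin⁺ _)
    where
    chosenAt-injective : ∀ {i j} → chosenAt i ≡ chosenAt j → i ≡ j
    chosenAt-injective = Injection.injective (Inverse⇒Injection slotIndex)
                       ∘ chosen-key-injective ∘ cong endpt₂ ∘ inj₂-injective

  chosenSet-length : length chosenSet ≡ suc q * 2 + r
  chosenSet-length = trans (length-map chosenAt (allFin _)) (length-tabulate id)

  chosen∈ : ∀ s → inj₂ (chosen s) ∈ chosenSet
  chosen∈ s = subst (_∈ chosenSet) (cong (inj₂ ∘ chosen) (Inverse.strictlyInverseˡ slotIndex s))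
                    (∈-map⁺ chosenAt (∈-allFin (Inverse.from slotIndex s)))

  ∈chosenSet : ∀ {u} → u ∈ chosenSet → ∃ λ s → u ≡ inj₂ (chosen s)
  ∈chosenSet u∈ with ∈-map⁻ chosenAt {xs = allFin (suc q * 2 + r)} u∈
  ... | i , _ , u≡ = Inverse.to slotIndex i , u≡

  vertex∉chosenSet : ∀ x → inj₁ x ∉ chosenSet
  vertex∉chosenSet x x∈ with ∈chosenSet x∈
  ... | _ , ()

  vertex-cases : ∀ x → (∃₂ λ j c → x ≡ triple j c) ⊎ (∃ λ t → x ≡ extra t)
  vertex-cases x with Inverse.to vertexLabel x | Inverse.strictlyInverseʳ vertexLabel x
  ... | inj₁ (j , c) | x≡ = inj₁ (j , c , sym x≡)
  ... | inj₂ t       | x≡ = inj₂ (t , sym x≡)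

  chosen-covers : ∀ x → ∃ λ s → Inc x (chosen s)
  chosen-covers x with vertex-cases x
  ... | inj₁ (j , zero , refl)             = path j zero , inj₁ refl
  ... | inj₁ (j , suc zero , refl)         = path j (suc zero) , inj₁ refl
  ... | inj₁ (j , suc (suc zero) , refl)   = path j (suc zero) , inj₂ refl
  ... | inj₂ (t , refl)                    = spoke t , inj₂ refl

  chosen-distinct : ∀ s s′ → s ≢ s′ → ¬ SameEnds (chosen s) (chosen s′)
  chosen-distinct _ _ s≢s′ (_ , key≡) = s≢s′ (chosen-key-injective key≡)

  chosen-has-neighbour : ∀ s → ∃ λ s′ → ShareEnd (chosen s) (chosen s′)
  chosen-has-neighbour (path j zero) =
    path j (suc zero) , chosen-distinct (path j zero) (path j (suc zero)) (λ ()) , inj₂ (inj₂ (inj₁ refl))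
  chosen-has-neighbour (path j (suc zero)) =
    path j zero , chosen-distinct (path j (suc zero)) (path j zero) (λ ()) , inj₂ (inj₁ refl)
  chosen-has-neighbour (spoke t) =
    path zero zero , chosen-distinct (spoke t) (path zero zero) (λ ()) , inj₁ refl

  centre hub : Fin n
  centre = triple zero (suc zero)
  hub    = triple zero (suc (suc zero))

  path-endpoint : ∀ j a {x} → Inc x (chosen (path j a)) → ∃ λ c → x ≡ triple j c
  path-endpoint _ _ (inj₁ x≡) = _ , x≡
  path-endpoint _ _ (inj₂ x≡) = _ , x≡

  chosen-at-hub : ∀ s {x} → Inc hub (chosen s) → Inc x (chosen s) → x ≡ centre ⊎ x ≡ hub
  chosen-at-hub (path j zero) (inj₁ hub≡) _
    with vertex-injective (inj₁ (zero , suc (suc zero))) (inj₁ (j , zero)) hub≡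
  ... | ()
  chosen-at-hub (path j (suc zero)) (inj₁ hub≡) _
    with vertex-injective (inj₁ (zero , suc (suc zero))) (inj₁ (j , suc zero)) hub≡
  ... | ()
  chosen-at-hub (path j a) (inj₂ hub≡) x∈
    with vertex-injective (inj₁ (zero , suc (suc zero))) (inj₁ (j , suc a)) hub≡
  ... | refl = x∈
  chosen-at-hub (spoke t) (inj₁ hub≡) _ with vertex-injective (inj₁ (zero , suc (suc zero))) (inj₁ (zero , zero)) hub≡
  ... | ()
  chosen-at-hub (spoke t) (inj₂ hub≡) _ with vertex-injective (inj₁ (zero , suc (suc zero))) (inj₂ t) hub≡
  ... | ()

  chosen-at-centre : ∀ s {x} → Inc centre (chosen s) → Inc x (chosen s) → ∃ λ c → x ≡ triple zero c
  chosen-at-centre (path j a) centre∈ x∈ with path-endpoint j a centre∈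
  ... | c , centre≡ with vertex-injective (inj₁ (zero , suc zero)) (inj₁ (j , c)) centre≡
  ... | refl = path-endpoint zero a x∈
  chosen-at-centre (spoke t) (inj₁ centre≡) _ with vertex-injective (inj₁ (zero , suc zero)) (inj₁ (zero , zero)) centre≡
  ... | ()
  chosen-at-centre (spoke t) (inj₂ centre≡) _ with vertex-injective (inj₁ (zero , suc zero)) (inj₂ t) centre≡
  ... | ()

  outsider : ∃ λ y → ∀ c → y ≢ triple zero c
  outsider = F.fromℕ< 3<n , λ c y≡ → n≮n 3 (subst (_< 3) (toℕ≡3 c y≡) (F.toℕ<n c))
    where
    toℕ≡3 : ∀ c → F.fromℕ< 3<n ≡ triple zero c → toℕ c ≡ 3
    toℕ≡3 c y≡ = trans (sym (toℕ-triple zero c)) (trans (cong toℕ (sym y≡)) (F.toℕ-fromℕ< 3<n))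

  Joined : Fin n → Fin n → Set
  Joined x y = ∃ λ s → Inc x (chosen s) × Inc y (chosen s)

  Walk : Fin n → Fin n → Set
  Walk x y = WalkIn M (_∉ chosenSet) (inj₁ x) (inj₁ y)

  walk-unjoined : ∀ {x y} → x ≢ y → ¬ Joined x y → Walk x y
  walk-unjoined {x} {y} x≢y ¬joined with joining-edge x≢y
  ... | e , x∈e , y∈e =
    walk-via-edge (vertex∉chosenSet x) (vertex∉chosenSet y) e∉chosenSet x∈e y∈e
    where
    e∉chosenSet : inj₂ e ∉ chosenSet
    e∉chosenSet e∈ with ∈chosenSet e∈
    ... | s , e≡ = ¬joined (s , subst (Inc x) (inj₂-injective e≡) x∈e , subst (Inc y) (inj₂-injective e≡) y∈e)

  walk-centre-hub : Walk centre hub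
  walk-centre-hub with outsider
  ... | y , y∉triple₀ = walk-++
    (walk-unjoined (λ centre≡y → y∉triple₀ (suc zero) (sym centre≡y))
                   (λ (s , centre∈ , y∈) → let c , y≡ = chosen-at-centre s centre∈ y∈ in y∉triple₀ c y≡))
    (walk-unjoined (y∉triple₀ (suc (suc zero)))
                   (λ (s , y∈ , hub∈) → [ y∉triple₀ (suc zero) , y∉triple₀ (suc (suc zero)) ]′ (chosen-at-hub s hub∈ y∈)))

  walk-to-hub : ∀ x → Walk x hub
  walk-to-hub x with x ≟ hub | x ≟ centre
  ... | yes refl | _           = here (vertex∉chosenSet hub)
  ... | no _     | yes refl    = walk-centre-hub
  ... | no x≢hub | no x≢centre =
    walk-unjoined x≢hub (λ (s , x∈ , hub∈) → [ x≢centre , x≢hub ]′ (chosen-at-hub s hub∈ x∈))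

  chosenSet-tocds : IsTOCDS M chosenSet
  chosenSet-tocds = chosenSet-unique
                  , totalDominating-middle chosenSet cover neighbour
                  , outerConnected-viaHub chosenSet hub vertex∉chosenSet walk-to-hub
    where
    cover : ∀ x → ∃ λ e → inj₂ e ∈ chosenSet × Inc x e
    cover x with chosen-covers x
    ... | s , x∈ = chosen s , chosen∈ s , x∈

    neighbour : ∀ e → inj₂ e ∈ chosenSet → ∃ λ f → inj₂ f ∈ chosenSet × ShareEnd e f
    neighbour e e∈ with ∈chosenSet e∈
    ... | s , refl with chosen-has-neighbour s
    ...   | s′ , e~f = chosen s′ , chosen∈ s′ , e~f

⌈2[3q+r]/3⌉≡2q+r : ∀ q r → r < 3 → ⌈ 2 * (q * 3 + r) /3⌉ ≡ q * 2 + r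
⌈2[3q+r]/3⌉≡2q+r q r r<3 = begin
  (2 * (q * 3 + r) + 2) / 3         ≡⟨ /-congˡ (regroup q r) ⟩
  (q * 2 * 3 + (2 * r + 2)) / 3     ≡⟨ +-distrib-/-∣ˡ (2 * r + 2) (divides-refl (q * 2)) ⟩
  q * 2 * 3 / 3 + (2 * r + 2) / 3   ≡⟨ cong₂ _+_ (m*n/n≡m (q * 2) 3) (small r<3) ⟩
  q * 2 + r                         ∎
  where
  open ≡-Reasoning
  regroup : ∀ q r → 2 * (q * 3 + r) + 2 ≡ q * 2 * 3 + (2 * r + 2)
  regroup = solve-∀
  small : ∀ {r} → r < 3 → (2 * r + 2) / 3 ≡ r
  small {0} _ = refl
  small {1} _ = refl
  small {2} _ = refl
  small {suc (suc (suc _))} (s≤s (s≤s (s≤s ())))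

TOCDSOfSize : ℕ → ℕ → Set
TOCDSOfSize n k = ∃ λ D → IsTOCDS (Middle n (Adj (K n))) D × length D ≡ k

tocds-of-size-⌈2n/3⌉ : ∀ n → 4 ≤ n → TOCDSOfSize n ⌈ 2 * n /3⌉
tocds-of-size-⌈2n/3⌉ n 4≤n with n divMod 3
... | result 0       r refl = ⊥-elim (<-asym (F.toℕ<n r) (subst (4 ≤_) (+-identityʳ (toℕ r)) 4≤n))
... | result (suc q) r refl =
  subst (λ m → TOCDSOfSize m ⌈ 2 * m /3⌉) (+-comm (suc q * 3) (toℕ r))
        (chosenSet , chosenSet-tocds , trans chosenSet-length (sym (⌈2[3q+r]/3⌉≡2q+r (suc q) (toℕ r) (F.toℕ<n r))))
  where open Construction q (toℕ r) (subst (4 ≤_) (+-comm (toℕ r) (suc q * 3)) 4≤n)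

theorem2p4 : (n : ℕ) → 4 ≤ n → γtc≡ (Middle n (Adj (K n))) ⌈ 2 * n /3⌉
theorem2p4 n 4≤n = tocds-of-size-⌈2n/3⌉ n 4≤n , λ D (_ , td , _) → 2n≤3m⇒⌈2n/3⌉≤m {n} (totalDominating-size td)
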